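{- Let $\mathbf A=(A;\wedge,d)$ be a finite regular SMB algebra and let $a,b,c,e\in A$ be such that $(c,e)\in\mathrm{Cg}^{\mathbf A}(a,b)$. Then there exist unary polynomial operations $p_1,\dots,p_6$ of $\mathbf A$ and elements $c=e_0,e_1,\dots,e_5,e_6=e$ of $A$ such that $\{p_i(a),p_i(b)\}=\{e_{i-1},e_i\}$ for $i=1,\dots,6$.
   Context: An algebra $\mathbf A=(A;\wedge,d)$ is idempotent if $x\wedge x=x$ and $d(x,x,x)=x$ for all $x$. For a congruence ${\sim}$ of $\mathbf A$, $\mathbf A$ is an SMB algebra over ${\sim}$ if it is idempotent, $(A/{\sim};\wedge)$ is a semilattice, and on each ${\sim}$-class $\wedge$ acts as the second projection and $d$ acts as a Mal'cev operation ($d(x,y,y)=x=d(y,y,x)$). Write $[u]_{\sim}\le[v]_{\sim}$ iff $[u]_{\sim}\wedge[v]_{\sim}=[u]_{\sim}$. An SMB algebra over ${\sim}$ is regular if (i) $[d(a,b,c)]_{\sim}=[(a\wedge b)\wedge c]_{\sim}$ for all $a,b,c$; (ii) $a\wedge b=b$ whenever $[a]_{\sim}\ge[b]_{\sim}$; (iii) it satisfies $d(x,y,z)\approx d((y\wedge z)\wedge x,(x\wedge z)\wedge y,(x\wedge y)\wedge z)$; (iv) it satisfies $(x\wedge y)\wedge y\approx x\wedge y$. A regular SMB algebra is one that is regular over some congruence. A unary polynomial operation is a map $x\mapsto t(x,c_1,\dots,c_k)$ for a term $t$ and constants $c_i\in A$. -}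

module Defs where

open import Data.Nat using (ℕ)
open import Data.Fin using (Fin)
open import Data.Product using (Σ; ∃; _×_; _,_)
open import Data.Sum using (_⊎_)
open import Function.Bundles using (_↔_)
open import Relation.Binary.PropositionalEquality using (_≡_)
open import Relation.Binary.Structures using (IsEquivalence)

record Algebra : Set₁ where
  field
    Carrier : Set
    _∧_     : Carrier → Carrier → Carrier
    d       : Carrier → Carrier → Carrier → Carrier
  infixl 7 _∧_

Finite : Algebra → Set
Finite 𝐀 = Σ ℕ λ n → Fin n ↔ Algebra.Carrier 𝐀

module _ (𝐀 : Algebra) where
  open Algebra 𝐀

  record IsCongruence (_∼_ : Carrier → Carrier → Set) : Set where
    field
      isEquivalence : IsEquivalence _∼_
      ∧-cong : ∀ {x x′ y y′} → x ∼ x′ → y ∼ y′ → (x ∧ y) ∼ (x′ ∧ y′)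
      d-cong : ∀ {x x′ y y′ z z′} → x ∼ x′ → y ∼ y′ → z ∼ z′ →
               d x y z ∼ d x′ y′ z′

  record IsRegularSMBOver (_∼_ : Carrier → Carrier → Set) : Set where
    field
      congruence : IsCongruence _∼_
      ∧-idem : ∀ x → x ∧ x ≡ x
      d-idem : ∀ x → d x x x ≡ x
      -- (A/∼; ∧) is a semilattice (idempotence follows from ∧-idem)
      ∧-comm-mod  : ∀ x y → (x ∧ y) ∼ (y ∧ x)
      ∧-assoc-mod : ∀ x y z → ((x ∧ y) ∧ z) ∼ (x ∧ (y ∧ z))
      -- on each ∼-class, ∧ is the second projection and d is Mal'cev
      ∧-proj₂ : ∀ x y → x ∼ y → x ∧ y ≡ y
      d-malcev₁ : ∀ x y → x ∼ y → d x y y ≡ x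
      d-malcev₂ : ∀ x y → x ∼ y → d y y x ≡ x
      -- regularity conditions (i)–(iv); [b] ≤ [a] means (b ∧ a) ∼ b
      reg-i   : ∀ a b c → d a b c ∼ ((a ∧ b) ∧ c)
      reg-ii  : ∀ a b → (b ∧ a) ∼ b → a ∧ b ≡ b
      reg-iii : ∀ x y z → d x y z ≡ d ((y ∧ z) ∧ x) ((x ∧ z) ∧ y) ((x ∧ y) ∧ z)
      reg-iv  : ∀ x y → (x ∧ y) ∧ y ≡ x ∧ y

  data Cg (a b : Carrier) : Carrier → Carrier → Set where
    base  : Cg a b a b
    refl  : ∀ {x} → Cg a b x x
    sym   : ∀ {x y} → Cg a b x y → Cg a b y x
    trans : ∀ {x y z} → Cg a b x y → Cg a b y z → Cg a b x z
    ∧-cong : ∀ {x x′ y y′} → Cg a b x x′ → Cg a b y y′ → Cg a b (x ∧ y) (x′ ∧ y′)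
    d-cong : ∀ {x x′ y y′ z z′} → Cg a b x x′ → Cg a b y y′ → Cg a b z z′ →
             Cg a b (d x y z) (d x′ y′ z′)

  data UPoly : Set where
    var   : UPoly
    const : Carrier → UPoly
    meet  : UPoly → UPoly → UPoly
    dd    : UPoly → UPoly → UPoly → UPoly

  ⟦_⟧ : UPoly → Carrier → Carrier
  ⟦ var ⟧ x = x
  ⟦ const c ⟧ x = c
  ⟦ meet p q ⟧ x = ⟦ p ⟧ x ∧ ⟦ q ⟧ x
  ⟦ dd p q r ⟧ x = d (⟦ p ⟧ x) (⟦ q ⟧ x) (⟦ r ⟧ x)

  IsRegularSMB : Set₁
  IsRegularSMB = ∃ λ (_∼_ : Carrier → Carrier → Set) → IsRegularSMBOver _∼_

SameTwoSet : {A : Set} → A → A → A → A → Set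
SameTwoSet x y u v = (x ≡ u × y ≡ v) ⊎ (x ≡ v × y ≡ u)

-- Write q = a ∧ b and call z low if [z] ≤ [a] or [z] ≤ [b]. The pairs (p(a), p(b)) with
-- p(a) ∼ p(b) form a congruence (Mal'cev on the ∼-classes), and together with all pairs of
-- low elements they form a congruence containing (a, b); so a pair (c, e) of Cg(a, b) is
-- either one polynomial step, or consists of two low elements. In the second case
-- c — q ∧ c — q ∧ e — e: a low c reaches q ∧ c in two steps, and (q ∧ c, q ∧ e) is a
-- single step because the polynomial closure of {(u, v) : (q ∧ u, q ∧ v) is such a pair}
-- is a congruence, which contains (a, b) since q ∧ p(a) ∼ q ∧ p(b) for every p.
module Submission where

open import Defs
open import Data.Fin using (Fin; zero; suc; inject₁; fromℕ)
open import Data.Nat using (ℕ; suc)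
open import Data.Product using (Σ; ∃; _×_; _,_; proj₁)
open import Data.Sum using (_⊎_; inj₁; inj₂)
import Data.Sum as Sum
open import Function using (_on_)
open import Relation.Binary.PropositionalEquality using (_≡_; refl; cong; cong₂; subst; subst₂)
import Relation.Binary.PropositionalEquality as ≡
open import Relation.Binary.Structures using (IsEquivalence)
open import Relation.Binary.Bundles using (Setoid)
import Relation.Binary.Construct.On as On
import Relation.Binary.Reasoning.Setoid as SetoidReasoning

module _ (𝐀 : Algebra) where
  open Algebra 𝐀

  ⟪_⟫ : UPoly 𝐀 → Carrier → Carrier
  ⟪_⟫ = ⟦_⟧ 𝐀

  _⊙_ : UPoly 𝐀 → UPoly 𝐀 → UPoly 𝐀
  var      ⊙ g = g
  const c  ⊙ g = const c
  meet p q ⊙ g = meet (p ⊙ g) (q ⊙ g)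
  dd p q r ⊙ g = dd (p ⊙ g) (q ⊙ g) (r ⊙ g)

  ⟪⊙⟫ : ∀ f g x → ⟪ f ⊙ g ⟫ x ≡ ⟪ f ⟫ (⟪ g ⟫ x)
  ⟪⊙⟫ var        g x = refl
  ⟪⊙⟫ (const c)  g x = refl
  ⟪⊙⟫ (meet p q) g x = cong₂ _∧_ (⟪⊙⟫ p g x) (⟪⊙⟫ q g x)
  ⟪⊙⟫ (dd p q r) g x =
    ≡.trans (cong₂ (λ u v → d u v _) (⟪⊙⟫ p g x) (⟪⊙⟫ q g x)) (cong (d _ _) (⟪⊙⟫ r g x))

  Cg⊆ : ∀ {R : Carrier → Carrier → Set} {a b} → IsCongruence 𝐀 R → R a b →
        ∀ {x y} → Cg 𝐀 a b x y → R x y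
  Cg⊆ {R} {a} {b} R-cong Rab = go
    where
    open IsCongruence R-cong renaming (∧-cong to R-∧-cong; d-cong to R-d-cong)
    open IsEquivalence isEquivalence renaming (refl to R-refl; sym to R-sym; trans to R-trans)
    go : ∀ {x y} → Cg 𝐀 a b x y → R x y
    go base                = Rab
    go refl                = R-refl
    go (sym h)             = R-sym (go h)
    go (trans h h′)        = R-trans (go h) (go h′)
    go (∧-cong h h′)       = R-∧-cong (go h) (go h′)
    go (d-cong h h′ h″)    = R-d-cong (go h) (go h′) (go h″)

  PolyClosed : (Carrier → Carrier → Set) → Carrier → Carrier → Set
  PolyClosed R x y = ∀ f → R (⟪ f ⟫ x) (⟪ f ⟫ y)

  module _ {R : Carrier → Carrier → Set} (R-equiv : IsEquivalence R) where
    open IsEquivalence R-equiv renaming (refl to R-refl; sym to R-sym; trans to R-trans)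

    PolyClosed-map : ∀ g {x y} → PolyClosed R x y → PolyClosed R (⟪ g ⟫ x) (⟪ g ⟫ y)
    PolyClosed-map g {x} {y} h f = subst₂ R (⟪⊙⟫ f g x) (⟪⊙⟫ f g y) (h (f ⊙ g))

    PolyClosed-isCongruence : IsCongruence 𝐀 (PolyClosed R)
    PolyClosed-isCongruence = record
      { isEquivalence = record
        { refl  = λ f → R-refl
        ; sym   = λ h f → R-sym (h f)
        ; trans = λ h h′ f → R-trans (h f) (h′ f)
        }
      ; ∧-cong = λ {_} {x′} {y} hx hy f →
          R-trans (PolyClosed-map (meet var (const y)) hx f)
                  (PolyClosed-map (meet (const x′) var) hy f)
      ; d-cong = λ {_} {x′} {y} {y′} {z} hx hy hz f →
          R-trans (R-trans (PolyClosed-map (dd var (const y) (const z)) hx f)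
                           (PolyClosed-map (dd (const x′) var (const z)) hy f))
                  (PolyClosed-map (dd (const x′) (const y′) var) hz f)
      }

  module _ (a b : Carrier) where

    PolyPair : Carrier → Carrier → Set
    PolyPair u v = Σ (UPoly 𝐀) λ p → ⟪ p ⟫ a ≡ u × ⟪ p ⟫ b ≡ v

    PolyPair-refl : ∀ x → PolyPair x x
    PolyPair-refl x = const x , refl , refl

    PolyPair-∧ : ∀ {x x′ y y′} → PolyPair x x′ → PolyPair y y′ → PolyPair (x ∧ y) (x′ ∧ y′)
    PolyPair-∧ (p , refl , refl) (q , refl , refl) = meet p q , refl , refl

    PolyPair-d : ∀ {x x′ y y′ z z′} → PolyPair x x′ → PolyPair y y′ → PolyPair z z′ →
                 PolyPair (d x y z) (d x′ y′ z′)
    PolyPair-d (p , refl , refl) (q , refl , refl) (r , refl , refl) = dd p q r , refl , refl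

    Step : Carrier → Carrier → Set
    Step u v = Σ (UPoly 𝐀) λ p → SameTwoSet (⟪ p ⟫ a) (⟪ p ⟫ b) u v

    PolyPair⇒Step : ∀ {u v} → PolyPair u v → Step u v
    PolyPair⇒Step (p , pa , pb) = p , inj₁ (pa , pb)

    Step-refl : ∀ {x} → Step x x
    Step-refl = PolyPair⇒Step (PolyPair-refl _)

    Step-sym : ∀ {u v} → Step u v → Step v u
    Step-sym (p , inj₁ (pa , pb)) = p , inj₂ (pa , pb)
    Step-sym (p , inj₂ (pa , pb)) = p , inj₁ (pa , pb)

    infixr 5 _∷_
    data Chain : ℕ → Carrier → Carrier → Set where
      []  : ∀ {x} → Chain 0 x x
      _∷_ : ∀ {n x y z} → Step x y → Chain n y z → Chain (suc n) x z

    Chain⇒indexed : ∀ {n c e} → Chain n c e →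
      Σ (Fin n → UPoly 𝐀) λ p → Σ (Fin (suc n) → Carrier) λ es →
        (es zero ≡ c) × (es (fromℕ n) ≡ e) ×
        (∀ i → SameTwoSet (⟪ p i ⟫ a) (⟪ p i ⟫ b) (es (inject₁ i)) (es (suc i)))
    Chain⇒indexed {c = c} [] = (λ ()) , (λ _ → c) , refl , refl , λ ()
    Chain⇒indexed {c = c} ((s , ss) ∷ ch) with Chain⇒indexed ch
    ... | p , es , es₀ , esₙ , steps = p′ , es′ , refl , esₙ , steps′
      where
      p′ : Fin _ → UPoly 𝐀
      p′ zero    = s
      p′ (suc i) = p i
      es′ : Fin _ → Carrier
      es′ zero    = c
      es′ (suc i) = es i
      steps′ : ∀ i → SameTwoSet (⟪ p′ i ⟫ a) (⟪ p′ i ⟫ b) (es′ (inject₁ i)) (es′ (suc i))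
      steps′ zero    = subst (SameTwoSet _ _ c) (≡.sym es₀) ss
      steps′ (suc i) = steps i

  module _ {_∼_ : Carrier → Carrier → Set} (reg : IsRegularSMBOver 𝐀 _∼_) where
    open IsRegularSMBOver reg
    open IsCongruence congruence renaming (∧-cong to ∼-∧-cong; d-cong to ∼-d-cong)
    open IsEquivalence isEquivalence renaming (refl to ∼-refl; sym to ∼-sym; trans to ∼-trans)

    ∼-setoid : Setoid _ _
    ∼-setoid = record { isEquivalence = isEquivalence }
    open SetoidReasoning ∼-setoid

    ≡⇒∼ : ∀ {x y} → x ≡ y → x ∼ y
    ≡⇒∼ refl = ∼-refl

    _≼_ : Carrier → Carrier → Set
    x ≼ w = (x ∧ w) ∼ x

    ≼-respˡ-∼ : ∀ {x x′ w} → x ∼ x′ → x ≼ w → x′ ≼ w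
    ≼-respˡ-∼ {x} {x′} {w} x∼x′ x≼w = begin
      x′ ∧ w ≈⟨ ∼-∧-cong (∼-sym x∼x′) ∼-refl ⟩
      x ∧ w  ≈⟨ x≼w ⟩
      x      ≈⟨ x∼x′ ⟩
      x′     ∎

    ≼-∧ˡ : ∀ {x y w} → x ≼ w → (x ∧ y) ≼ w
    ≼-∧ˡ {x} {y} {w} x≼w = begin
      (x ∧ y) ∧ w ≈⟨ ∧-assoc-mod x y w ⟩
      x ∧ (y ∧ w) ≈⟨ ∼-∧-cong ∼-refl (∧-comm-mod y w) ⟩
      x ∧ (w ∧ y) ≈⟨ ∼-sym (∧-assoc-mod x w y) ⟩
      (x ∧ w) ∧ y ≈⟨ ∼-∧-cong x≼w ∼-refl ⟩
      x ∧ y       ∎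

    ≼-∧ʳ : ∀ {x y w} → y ≼ w → (x ∧ y) ≼ w
    ≼-∧ʳ {x} {y} {w} y≼w = begin
      (x ∧ y) ∧ w ≈⟨ ∧-assoc-mod x y w ⟩
      x ∧ (y ∧ w) ≈⟨ ∼-∧-cong ∼-refl y≼w ⟩
      x ∧ y       ∎

    ∧-distribˡ-∧ : ∀ q x y → (q ∧ (x ∧ y)) ∼ ((q ∧ x) ∧ (q ∧ y))
    ∧-distribˡ-∧ q x y = ∼-sym (begin
      (q ∧ x) ∧ (q ∧ y) ≈⟨ ∧-assoc-mod q x (q ∧ y) ⟩
      q ∧ (x ∧ (q ∧ y)) ≈⟨ ∼-∧-cong ∼-refl (∼-sym (∧-assoc-mod x q y)) ⟩
      q ∧ ((x ∧ q) ∧ y) ≈⟨ ∼-∧-cong ∼-refl (∼-∧-cong (∧-comm-mod x q) ∼-refl) ⟩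
      q ∧ ((q ∧ x) ∧ y) ≈⟨ ∼-∧-cong ∼-refl (∧-assoc-mod q x y) ⟩
      q ∧ (q ∧ (x ∧ y)) ≈⟨ ∼-sym (∧-assoc-mod q q (x ∧ y)) ⟩
      (q ∧ q) ∧ (x ∧ y) ≡⟨ cong (_∧ (x ∧ y)) (∧-idem q) ⟩
      q ∧ (x ∧ y)       ∎)

    ∧-distribˡ-d : ∀ q x y z → (q ∧ d x y z) ∼ (((q ∧ x) ∧ (q ∧ y)) ∧ (q ∧ z))
    ∧-distribˡ-d q x y z = begin
      q ∧ d x y z                   ≈⟨ ∼-∧-cong ∼-refl (reg-i x y z) ⟩
      q ∧ ((x ∧ y) ∧ z)             ≈⟨ ∧-distribˡ-∧ q (x ∧ y) z ⟩
      (q ∧ (x ∧ y)) ∧ (q ∧ z)       ≈⟨ ∼-∧-cong (∧-distribˡ-∧ q x y) ∼-refl ⟩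
      ((q ∧ x) ∧ (q ∧ y)) ∧ (q ∧ z) ∎

    module _ (a b : Carrier) where

      ClassPolyPair : Carrier → Carrier → Set
      ClassPolyPair u v = PolyPair a b u v × u ∼ v

      PolyPair-swap : ∀ {x y} → PolyPair a b x y → x ∼ y → PolyPair a b y x
      PolyPair-swap {x} {y} (p , refl , refl) x∼y =
        dd (const x) p (const y) , d-malcev₂ y x (∼-sym x∼y) , d-malcev₁ x y x∼y

      PolyPair-compose : ∀ {x y z} → PolyPair a b x y → PolyPair a b y z → x ∼ y → y ∼ z →
                         PolyPair a b x z
      PolyPair-compose {x} {y} {z} (p , refl , refl) (q , qa , refl) x∼y y∼z =
        dd p (const y) q , ≡.trans (cong (d x y) qa) (d-malcev₁ x y x∼y)
                         , d-malcev₂ z y (∼-sym y∼z)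

      ClassPolyPair-isCongruence : IsCongruence 𝐀 ClassPolyPair
      ClassPolyPair-isCongruence = record
        { isEquivalence = record
          { refl  = PolyPair-refl a b _ , ∼-refl
          ; sym   = λ (p , s) → PolyPair-swap p s , ∼-sym s
          ; trans = λ (p , s) (p′ , s′) → PolyPair-compose p p′ s s′ , ∼-trans s s′
          }
        ; ∧-cong = λ (p , s) (p′ , s′) → PolyPair-∧ a b p p′ , ∼-∧-cong s s′
        ; d-cong = λ (p , s) (p′ , s′) (p″ , s″) → PolyPair-d a b p p′ p″ , ∼-d-cong s s′ s″
        }

      Lower : Carrier → Set
      Lower z = z ≼ a ⊎ z ≼ b

      Lower-resp-∼ : ∀ {x x′} → x ∼ x′ → Lower x → Lower x′
      Lower-resp-∼ x∼x′ = Sum.map (≼-respˡ-∼ x∼x′) (≼-respˡ-∼ x∼x′)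

      Lower-∧ˡ : ∀ {x y} → Lower x → Lower (x ∧ y)
      Lower-∧ˡ = Sum.map ≼-∧ˡ ≼-∧ˡ

      Lower-∧ʳ : ∀ {x y} → Lower y → Lower (x ∧ y)
      Lower-∧ʳ = Sum.map ≼-∧ʳ ≼-∧ʳ

      Lower-d : ∀ {x y z} → Lower ((x ∧ y) ∧ z) → Lower (d x y z)
      Lower-d {x} {y} {z} = Lower-resp-∼ (∼-sym (reg-i x y z))

      Dichotomy : Carrier → Carrier → Set
      Dichotomy x y = ClassPolyPair x y ⊎ (Lower x × Lower y)

      Dichotomy-isCongruence : IsCongruence 𝐀 Dichotomy
      Dichotomy-isCongruence = record
        { isEquivalence = record { refl = inj₁ CE.refl ; sym = sym′ ; trans = trans′ }
        ; ∧-cong = ∧-cong′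
        ; d-cong = d-cong′
        }
        where
        module C = IsCongruence ClassPolyPair-isCongruence
        module CE = IsEquivalence C.isEquivalence

        sym′ : ∀ {x y} → Dichotomy x y → Dichotomy y x
        sym′ (inj₁ p)         = inj₁ (CE.sym p)
        sym′ (inj₂ (lx , ly)) = inj₂ (ly , lx)

        trans′ : ∀ {x y z} → Dichotomy x y → Dichotomy y z → Dichotomy x z
        trans′ (inj₁ p)         (inj₁ p′)        = inj₁ (CE.trans p p′)
        trans′ (inj₁ (_ , x∼y)) (inj₂ (ly , lz)) = inj₂ (Lower-resp-∼ (∼-sym x∼y) ly , lz)
        trans′ (inj₂ (lx , ly)) (inj₁ (_ , y∼z)) = inj₂ (lx , Lower-resp-∼ y∼z ly)
        trans′ (inj₂ (lx , _))  (inj₂ (_ , lz))  = inj₂ (lx , lz)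

        ∧-cong′ : ∀ {x x′ y y′} → Dichotomy x x′ → Dichotomy y y′ → Dichotomy (x ∧ y) (x′ ∧ y′)
        ∧-cong′ (inj₁ p)         (inj₁ p′)        = inj₁ (C.∧-cong p p′)
        ∧-cong′ (inj₂ (lx , lx′)) _               = inj₂ (Lower-∧ˡ lx , Lower-∧ˡ lx′)
        ∧-cong′ (inj₁ _)         (inj₂ (ly , ly′)) = inj₂ (Lower-∧ʳ ly , Lower-∧ʳ ly′)

        d-cong′ : ∀ {x x′ y y′ z z′} → Dichotomy x x′ → Dichotomy y y′ → Dichotomy z z′ →
                  Dichotomy (d x y z) (d x′ y′ z′)
        d-cong′ (inj₁ p) (inj₁ p′) (inj₁ p″) = inj₁ (C.d-cong p p′ p″)
        d-cong′ (inj₂ (l , l′)) _ _ =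
          inj₂ (Lower-d (Lower-∧ˡ (Lower-∧ˡ l)) , Lower-d (Lower-∧ˡ (Lower-∧ˡ l′)))
        d-cong′ (inj₁ _) (inj₂ (l , l′)) _ =
          inj₂ (Lower-d (Lower-∧ˡ (Lower-∧ʳ l)) , Lower-d (Lower-∧ˡ (Lower-∧ʳ l′)))
        d-cong′ (inj₁ _) (inj₁ _) (inj₂ (l , l′)) =
          inj₂ (Lower-d (Lower-∧ʳ l) , Lower-d (Lower-∧ʳ l′))

      Cg⇒Dichotomy : ∀ {x y} → Cg 𝐀 a b x y → Dichotomy x y
      Cg⇒Dichotomy = Cg⊆ Dichotomy-isCongruence
        (inj₂ (inj₁ (≡⇒∼ (∧-idem a)) , inj₂ (≡⇒∼ (∧-idem b))))

      q : Carrier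
      q = a ∧ b

      q∧-invariant : ∀ f → (q ∧ ⟪ f ⟫ a) ∼ (q ∧ ⟪ f ⟫ b)
      q∧-invariant var = begin
        (a ∧ b) ∧ a ≈⟨ ∼-∧-cong (∧-comm-mod a b) ∼-refl ⟩
        (b ∧ a) ∧ a ≡⟨ reg-iv b a ⟩
        b ∧ a       ≈⟨ ∧-comm-mod b a ⟩
        a ∧ b       ≡⟨ ≡.sym (reg-iv a b) ⟩
        (a ∧ b) ∧ b ∎
      q∧-invariant (const c) = ∼-refl
      q∧-invariant (meet f g) =
        ∼-trans (∧-distribˡ-∧ q _ _)
          (∼-trans (∼-∧-cong (q∧-invariant f) (q∧-invariant g)) (∼-sym (∧-distribˡ-∧ q _ _)))
      q∧-invariant (dd f g h) =
        ∼-trans (∧-distribˡ-d q _ _ _)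
          (∼-trans (∼-∧-cong (∼-∧-cong (q∧-invariant f) (q∧-invariant g)) (q∧-invariant h))
                   (∼-sym (∧-distribˡ-d q _ _ _)))

      Cg⇒ClassPolyPair-q∧ : ∀ {x y} → Cg 𝐀 a b x y → ClassPolyPair (q ∧ x) (q ∧ y)
      Cg⇒ClassPolyPair-q∧ h = Cg⊆ (PolyClosed-isCongruence q∧-equiv) q∧-ab h var
        where
        q∧-equiv : IsEquivalence (ClassPolyPair on (q ∧_))
        q∧-equiv = On.isEquivalence (q ∧_) (IsCongruence.isEquivalence ClassPolyPair-isCongruence)
        q∧-ab : PolyClosed (ClassPolyPair on (q ∧_)) a b
        q∧-ab f = (meet (const q) f , refl , refl) , q∧-invariant f

      -- reg-ii turns c ≼ a into a ∧ c ≡ c, so var ∧ c sends (a, b) to (c, b ∧ c).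
      Lower⇒Step²-q∧ : ∀ {c} → Lower c → ∃ λ m → Step a b c m × Step a b m (q ∧ c)
      Lower⇒Step²-q∧ {c} (inj₁ c≼a) = b ∧ c ,
        (meet var (const c) , inj₁ (reg-ii a c c≼a , refl)) ,
        (meet (meet var (const b)) (const c) , inj₂ (refl , cong (_∧ c) (∧-idem b)))
      Lower⇒Step²-q∧ {c} (inj₂ c≼b) = a ∧ c ,
        (meet var (const c) , inj₂ (refl , reg-ii b c c≼b)) ,
        (meet (meet (const a) var) (const c) , inj₁ (cong (_∧ c) (∧-idem a) , refl))

      Cg⇒Chain : ∀ {c e} → Cg 𝐀 a b c e → Chain a b 6 c e
      Cg⇒Chain h with Cg⇒Dichotomy h
      ... | inj₁ (p , _) =
        PolyPair⇒Step a b p ∷ Step-refl a b ∷ Step-refl a b ∷ Step-refl a b ∷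
        Step-refl a b ∷ Step-refl a b ∷ []
      ... | inj₂ (lc , le) with Lower⇒Step²-q∧ lc | Lower⇒Step²-q∧ le
      ... | _ , s₁ , s₂ | _ , t₁ , t₂ =
        s₁ ∷ s₂ ∷ PolyPair⇒Step a b (proj₁ (Cg⇒ClassPolyPair-q∧ h)) ∷
        Step-sym a b t₂ ∷ Step-sym a b t₁ ∷ Step-refl a b ∷ []

corollary6p4 : (𝐀 : Algebra) → Finite 𝐀 → IsRegularSMB 𝐀 →
    (a b c e : Algebra.Carrier 𝐀) → Cg 𝐀 a b c e →
    Σ (Fin 6 → UPoly 𝐀) λ p → Σ (Fin 7 → Algebra.Carrier 𝐀) λ es →
      (es zero ≡ c) × (es (fromℕ 6) ≡ e) ×
      (∀ (i : Fin 6) → SameTwoSet (⟦_⟧ 𝐀 (p i) a) (⟦_⟧ 𝐀 (p i) b) (es (inject₁ i)) (es (suc i)))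
corollary6p4 𝐀 _ (_ , reg) a b c e h = Chain⇒indexed 𝐀 a b (Cg⇒Chain 𝐀 reg a b h)
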